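{- For every positive integer $n$, every orbit of the Lehmer code rotation $\mathcal{L}$ on $S_n$ has size $\mathrm{lcm}(1,2,\dots,n)$.
   Context: For $\sigma\in S_n$ (one-line notation), the Lehmer code is $L(\sigma)=(L(\sigma)_1,\dots,L(\sigma)_n)$ with $L(\sigma)_i=\#\{j>i:\sigma_j<\sigma_i\}\in\{0,\dots,n-i\}$; this is a bijection from $S_n$ to such tuples. The Lehmer code rotation $\mathcal{L}$ sends $\sigma$ to the unique $\tau\in S_n$ with $L(\tau)_i\equiv L(\sigma)_i+1\pmod{n-i+1}$ for all $i$. -}

module Defs where

open import Data.Nat using (ℕ; zero; suc; _<?_)
open import Data.Nat.DivMod using (_%_)
open import Data.Nat.LCM using (lcm)
open import Data.List using (List; []; _∷_; length; filter; upTo; map; foldr)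
open import Data.Product using (_×_; _,_; proj₁; proj₂)

-- Permutations of S_n are represented in one-line notation as lists of
-- natural numbers that are a rearrangement of  upTo n = [0, 1, ..., n-1]
-- (values shifted down by one: the value k stands for k+1).

lehmer : List ℕ → List ℕ
lehmer []       = []
lehmer (x ∷ xs) = length (filter (λ y → y <? x) xs) ∷ lehmer xs

-- Rotation of a code: the entry at (1-based) position i of a code of length n
-- is replaced by (entry + 1) mod (n - i + 1); n - i + 1 = number of entries
-- from position i to the end.
rotCode : List ℕ → List ℕ
rotCode []       = []
rotCode (c ∷ cs) = (suc c % suc (length cs)) ∷ rotCode cs

pick : ℕ → List ℕ → ℕ × List ℕ
pick _       []       = 0 , []
pick zero    (x ∷ xs) = x , xs
pick (suc k) (x ∷ xs) with pick k xs
... | y , r = y , x ∷ r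

-- Inverse of the Lehmer code: given the increasing list of still available
-- values, the entry c selects the c-th smallest available value.
decodeFrom : List ℕ → List ℕ → List ℕ
decodeFrom avail []       = []
decodeFrom avail (c ∷ cs) with pick c avail
... | y , rest = y ∷ decodeFrom rest cs

lehmerInv : ℕ → List ℕ → List ℕ
lehmerInv n code = decodeFrom (upTo n) code

𝓛 : ℕ → List ℕ → List ℕ
𝓛 n σ = lehmerInv n (rotCode (lehmer σ))

iter : {A : Set} → (A → A) → ℕ → A → A
iter f zero    x = x
iter f (suc k) x = f (iter f k x)

lcmUpTo : ℕ → ℕ
lcmUpTo n = foldr lcm 1 (map suc (upTo n))

module Submission where

open import Defs
open import Data.Nat using (ℕ; _≥_)
open import Data.List using (List; length; upTo)
open import Data.List.Relation.Binary.Permutation.Propositional using (_↭_)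
open import Data.List.Relation.Unary.Unique.Propositional using (Unique)
open import Data.List.Membership.Propositional using (_∈_)
open import Data.Product using (Σ; ∃; _×_)
open import Function.Bundles using (_⇔_)
open import Relation.Binary.PropositionalEquality using (_≡_)

open import Data.Nat using (zero; suc; _+_; _*_; _∸_; _≤_; _<_; _!; s≤s; s≤s⁻¹; NonZero; ≢-nonZero; ≢-nonZero⁻¹; >-nonZero)
open import Data.Nat.Properties
open import Data.Nat.DivMod using (_%_; _/_; m≡m%n+[m/n]*n; m%n%n≡m%n; %-distribˡ-+; %-remove-+ʳ; m%n<n; m≤n⇒m%n≡m)
open import Data.Nat.Divisibility using (_∣_; divides; ∣-refl; ∣-trans; 1∣_; 0∣⇒≡0; ∣⇒≤; m∣m*n; m≤n⇒m!∣n!)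
open import Data.Nat.LCM using (lcm; m∣lcm[m,n]; n∣lcm[m,n]; lcm-least)
open import Data.List using ([]; _∷_; _++_; filter; map; foldr; applyUpTo)
open import Data.List.Properties using (length-applyUpTo; length-filter; length-upTo; length-++-sucʳ; ++-identityʳ; ∷-injective; filter-++; filter-all; filter-none)
open import Data.List.Relation.Unary.All as All using (All; []; _∷_)
import Data.List.Relation.Unary.All.Properties as AllP
open import Data.List.Relation.Unary.AllPairs using (AllPairs; []; _∷_)
import Data.List.Relation.Unary.AllPairs.Properties as AllPairsP
open import Data.List.Relation.Unary.Any using (here)
open import Data.List.Membership.Propositional.Properties using (∈-∃++; ∈-applyUpTo⁺; ∈-applyUpTo⁻)
open import Data.List.Relation.Binary.Permutation.Propositional using (prep; ↭-refl; ↭-sym; ↭-trans)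
open import Data.List.Relation.Binary.Permutation.Propositional.Properties using (shift; drop-mid; filter-↭; ↭-length; ∈-resp-↭)
open import Data.Product using (_,_)
open import Data.Sum using (inj₁; inj₂)
open import Function using (id)
open import Function.Bundles using (mk⇔; module Equivalence)
open import Relation.Binary.PropositionalEquality using (refl; sym; trans; cong; cong₂; subst; _≢_; module ≡-Reasoning)

open Equivalence using (to; from)
open ≡-Reasoning

-- The Lehmer code conjugates 𝓛 to the rotation of codes, and the rotation acts on
-- each entry independently: the entry with m entries from it to the end of the code
-- is increased by one modulo m.  Hence the k-th rotate of a code of length n equals
-- the code exactly when every m ≤ n divides k, i.e. when lcm(1, …, n) divides k,
-- and the orbit of a point under a map of exact period p consists of p distinct points.

[m+n]%o≡m⇒o∣n : ∀ m n o .{{_ : NonZero o}} → (m + n) % o ≡ m → o ∣ n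
[m+n]%o≡m⇒o∣n m n o eq = divides ((m + n) / o) (+-cancelˡ-≡ m n _ (begin
  m + n                         ≡⟨ m≡m%n+[m/n]*n (m + n) o ⟩
  (m + n) % o + (m + n) / o * o ≡⟨ cong (_+ (m + n) / o * o) eq ⟩
  m + (m + n) / o * o           ∎))

suc[m%n]%n≡suc[m]%n : ∀ m n .{{_ : NonZero n}} → suc (m % n) % n ≡ suc m % n
suc[m%n]%n≡suc[m]%n m n = begin
  (1 + m % n) % n         ≡⟨ %-distribˡ-+ 1 (m % n) n ⟩
  (1 % n + m % n % n) % n ≡⟨ cong (λ r → (1 % n + r) % n) (m%n%n≡m%n m n) ⟩
  (1 % n + m % n) % n     ≡⟨ %-distribˡ-+ 1 m n ⟨
  (1 + m) % n             ∎

foldr-lcm-∣⇔ : ∀ xs {d} → foldr lcm 1 xs ∣ d ⇔ All (_∣ d) xs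
foldr-lcm-∣⇔ []       = mk⇔ (λ _ → []) (λ _ → 1∣ _)
foldr-lcm-∣⇔ (x ∷ xs) = mk⇔
  (λ l∣d → ∣-trans (m∣lcm[m,n] x _) l∣d
         ∷ to (foldr-lcm-∣⇔ xs) (∣-trans (n∣lcm[m,n] x _) l∣d))
  (λ { (x∣d ∷ xs∣d) → lcm-least x∣d (from (foldr-lcm-∣⇔ xs) xs∣d) })

lcmUpTo-∣⇔ : ∀ n {d} → lcmUpTo n ∣ d ⇔ (∀ {m} → m < n → suc m ∣ d)
lcmUpTo-∣⇔ n {d} = mk⇔ divisors-∣ divisors-∣⁻¹
  where
  divisors-∣ : lcmUpTo n ∣ d → ∀ {m} → m < n → suc m ∣ d
  divisors-∣ l∣d = AllP.applyUpTo⁻ id n (AllP.map⁻ (to (foldr-lcm-∣⇔ (map suc (upTo n))) l∣d))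
  divisors-∣⁻¹ : (∀ {m} → m < n → suc m ∣ d) → lcmUpTo n ∣ d
  divisors-∣⁻¹ all∣d = from (foldr-lcm-∣⇔ (map suc (upTo n))) (AllP.map⁺ (AllP.applyUpTo⁺₁ id n all∣d))

lcmUpTo∣n! : ∀ n → lcmUpTo n ∣ n !
lcmUpTo∣n! n = from (lcmUpTo-∣⇔ n) (λ {m} m<n → ∣-trans (m∣m*n (m !)) (m≤n⇒m!∣n! m<n))

lcmUpTo-nonZero : ∀ n → NonZero (lcmUpTo n)
lcmUpTo-nonZero n = ≢-nonZero λ l≡0 →
  ≢-nonZero⁻¹ (n !) {{n !≢0}} (0∣⇒≡0 (subst (_∣ n !) l≡0 (lcmUpTo∣n! n)))

module _ {A : Set} (f : A → A) where

  iter-+ : ∀ m n x → iter f (m + n) x ≡ iter f m (iter f n x)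
  iter-+ zero    n x = refl
  iter-+ (suc m) n x = cong f (iter-+ m n x)

  iter-* : ∀ {p x} → iter f p x ≡ x → ∀ q → iter f (q * p) x ≡ x
  iter-*         period zero    = refl
  iter-* {p} {x} period (suc q) = begin
    iter f (p + q * p) x        ≡⟨ iter-+ p (q * p) x ⟩
    iter f p (iter f (q * p) x) ≡⟨ cong (iter f p) (iter-* period q) ⟩
    iter f p x                  ≡⟨ period ⟩
    x                           ∎

  iter-% : ∀ {p x} .{{_ : NonZero p}} → iter f p x ≡ x → ∀ k → iter f (k % p) x ≡ iter f k x
  iter-% {p} {x} period k = begin
    iter f (k % p) x                      ≡⟨ cong (iter f (k % p)) (iter-* period (k / p)) ⟨
    iter f (k % p) (iter f (k / p * p) x) ≡⟨ iter-+ (k % p) (k / p * p) x ⟨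
    iter f (k % p + k / p * p) x          ≡⟨ cong (λ j → iter f j x) (m≡m%n+[m/n]*n k p) ⟨
    iter f k x                            ∎

  orbit-of-exact-period : ∀ x p .{{_ : NonZero p}} →
    iter f p x ≡ x →
    (∀ i d → iter f (d + i) x ≡ iter f i x → p ∣ d) →
    Σ (List A) λ orb →
      Unique orb × length orb ≡ p × (∀ y → y ∈ orb ⇔ ∃ λ k → iter f k x ≡ y)
  orbit-of-exact-period x p period minimal =
    applyUpTo orbit p ,
    AllPairsP.applyUpTo⁺₁ orbit p distinct ,
    length-applyUpTo orbit p ,
    λ y → mk⇔
      (λ y∈ → let i , _ , y≡ = ∈-applyUpTo⁻ orbit y∈ in i , sym y≡)
      (λ (k , orbit-k≡y) → subst (_∈ applyUpTo orbit p) (trans (iter-% period k) orbit-k≡y)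
                                 (∈-applyUpTo⁺ orbit (m%n<n k p)))
    where
    orbit : ℕ → A
    orbit k = iter f k x

    distinct : ∀ {i j} → i < j → j < p → orbit i ≢ orbit j
    distinct {i} {j} i<j j<p orbit-i≡orbit-j =
      <⇒≱ j<p (≤-trans (∣⇒≤ {{>-nonZero (m<n⇒0<n∸m i<j)}} p∣j∸i) (m∸n≤m j i))
      where
      p∣j∸i : p ∣ j ∸ i
      p∣j∸i = minimal i (j ∸ i)
        (trans (cong orbit (m∸n+n≡m (<⇒≤ i<j))) (sym orbit-i≡orbit-j))

data IsCode : List ℕ → Set where
  []  : IsCode []
  _∷_ : ∀ {c cs} → c ≤ length cs → IsCode cs → IsCode (c ∷ cs)

length-rotCode : ∀ cs → length (rotCode cs) ≡ length cs
length-rotCode []       = refl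
length-rotCode (c ∷ cs) = cong suc (length-rotCode cs)

rotCode-isCode : ∀ {cs} → IsCode cs → IsCode (rotCode cs)
rotCode-isCode []                     = []
rotCode-isCode {c ∷ cs} (_ ∷ cs-code) =
  subst (suc c % suc (length cs) ≤_) (sym (length-rotCode cs)) (s≤s⁻¹ (m%n<n (suc c) _))
  ∷ rotCode-isCode cs-code

length-iter-rotCode : ∀ k cs → length (iter rotCode k cs) ≡ length cs
length-iter-rotCode zero    cs = refl
length-iter-rotCode (suc k) cs = trans (length-rotCode (iter rotCode k cs)) (length-iter-rotCode k cs)

iter-rotCode-isCode : ∀ k {cs} → IsCode cs → IsCode (iter rotCode k cs)
iter-rotCode-isCode zero    cs-code = cs-code
iter-rotCode-isCode (suc k) cs-code = rotCode-isCode (iter-rotCode-isCode k cs-code)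

iter-rotCode-[] : ∀ k → iter rotCode k [] ≡ []
iter-rotCode-[] zero    = refl
iter-rotCode-[] (suc k) = cong rotCode (iter-rotCode-[] k)

iter-rotCode-∷ : ∀ k {c cs} → c ≤ length cs →
  iter rotCode k (c ∷ cs) ≡ (c + k) % suc (length cs) ∷ iter rotCode k cs
iter-rotCode-∷ zero {c} c≤l =
  cong (_∷ _) (sym (trans (cong (_% _) (+-identityʳ c)) (m≤n⇒m%n≡m c≤l)))
iter-rotCode-∷ (suc k) {c} {cs} c≤l = begin
  rotCode (iter rotCode k (c ∷ cs))
    ≡⟨ cong rotCode (iter-rotCode-∷ k c≤l) ⟩
  suc ((c + k) % M) % suc (length (iter rotCode k cs)) ∷ iter rotCode (suc k) cs
    ≡⟨ cong (λ l → suc ((c + k) % M) % suc l ∷ iter rotCode (suc k) cs) (length-iter-rotCode k cs) ⟩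
  suc ((c + k) % M) % M ∷ iter rotCode (suc k) cs
    ≡⟨ cong (_∷ iter rotCode (suc k) cs)
            (trans (suc[m%n]%n≡suc[m]%n (c + k) M) (cong (_% M) (sym (+-suc c k)))) ⟩
  (c + suc k) % M ∷ iter rotCode (suc k) cs
    ∎
  where M = suc (length cs)

iter-rotCode-fixed⇒ : ∀ {d cs} → IsCode cs → iter rotCode d cs ≡ cs →
  ∀ {m} → m < length cs → suc m ∣ d
iter-rotCode-fixed⇒ {d} {c ∷ cs} (c≤l ∷ cs-code) fixed m<
  with ∷-injective (trans (sym (iter-rotCode-∷ d c≤l)) fixed) | m≤n⇒m<n∨m≡n (s≤s⁻¹ m<)
... | _          , tail-fixed | inj₁ m<l = iter-rotCode-fixed⇒ cs-code tail-fixed m<l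
... | head-fixed , _          | inj₂ refl = [m+n]%o≡m⇒o∣n c d _ head-fixed

iter-rotCode-fixed⇐ : ∀ {d cs} → IsCode cs → (∀ {m} → m < length cs → suc m ∣ d) →
  iter rotCode d cs ≡ cs
iter-rotCode-fixed⇐ {d} []                          _     = iter-rotCode-[] d
iter-rotCode-fixed⇐ {d} {c ∷ cs} (c≤l ∷ cs-code) all∣d = begin
  iter rotCode d (c ∷ cs)                       ≡⟨ iter-rotCode-∷ d c≤l ⟩
  (c + d) % suc (length cs) ∷ iter rotCode d cs ≡⟨ cong₂ _∷_ head-fixed tail-fixed ⟩
  c ∷ cs                                        ∎
  where
  head-fixed : (c + d) % suc (length cs) ≡ c
  head-fixed = trans (%-remove-+ʳ c (all∣d ≤-refl)) (m≤n⇒m%n≡m c≤l)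
  tail-fixed : iter rotCode d cs ≡ cs
  tail-fixed = iter-rotCode-fixed⇐ cs-code (λ m<l → all∣d (m<n⇒m<1+n m<l))

iter-rotCode≡id⇔ : ∀ {d cs} → IsCode cs → iter rotCode d cs ≡ cs ⇔ lcmUpTo (length cs) ∣ d
iter-rotCode≡id⇔ cs-code = mk⇔
  (λ fixed → from (lcmUpTo-∣⇔ _) (iter-rotCode-fixed⇒ cs-code fixed))
  (λ l∣d → iter-rotCode-fixed⇐ cs-code (to (lcmUpTo-∣⇔ _) l∣d))

length-lehmer : ∀ xs → length (lehmer xs) ≡ length xs
length-lehmer []       = refl
length-lehmer (x ∷ xs) = cong suc (length-lehmer xs)

lehmer-isCode : ∀ xs → IsCode (lehmer xs)
lehmer-isCode []       = []
lehmer-isCode (x ∷ xs) =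
  subst (length (filter (_<? x) xs) ≤_) (sym (length-lehmer xs)) (length-filter (_<? x) xs)
  ∷ lehmer-isCode xs

Sorted : List ℕ → Set
Sorted = AllPairs _<_

sorted-++-∷⁻ : ∀ pre {y post} → Sorted (pre ++ y ∷ post) →
  All (_< y) pre × All (y <_) post × Sorted (pre ++ post)
sorted-++-∷⁻ []        (y<post ∷ sorted) = [] , y<post , sorted
sorted-++-∷⁻ (x ∷ pre) (x<rest ∷ sorted) with sorted-++-∷⁻ pre sorted | AllP.++⁻ pre x<rest
... | pre<y , y<post , sorted′ | x<pre , x<y ∷ x<post =
  x<y ∷ pre<y , y<post , AllP.++⁺ x<pre x<post ∷ sorted′

count-<-↭ : ∀ pre {y post zs} → All (_< y) pre → All (y <_) post → zs ↭ pre ++ post →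
  length (filter (_<? y) zs) ≡ length pre
count-<-↭ pre {y} {post} {zs} pre<y y<post zs↭ = begin
  length (filter (_<? y) zs)                         ≡⟨ ↭-length (filter-↭ (_<? y) zs↭) ⟩
  length (filter (_<? y) (pre ++ post))              ≡⟨ cong length (filter-++ (_<? y) pre post) ⟩
  length (filter (_<? y) pre ++ filter (_<? y) post) ≡⟨ cong₂ (λ as bs → length (as ++ bs))
                                                              (filter-all (_<? y) pre<y)
                                                              (filter-none (_<? y) (All.map <⇒≯ y<post)) ⟩
  length (pre ++ [])                                 ≡⟨ cong length (++-identityʳ pre) ⟩
  length pre                                         ∎

split-at : ∀ {c} (xs : List ℕ) → c < length xs →
  Σ (List ℕ) λ pre → Σ ℕ λ y → Σ (List ℕ) λ post → xs ≡ pre ++ y ∷ post × length pre ≡ c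
split-at {zero}  (x ∷ xs) _ = [] , x , xs , refl , refl
split-at {suc c} (x ∷ xs) c<l with split-at {c} xs (s≤s⁻¹ c<l)
... | pre , y , post , refl , refl = x ∷ pre , y , post , refl , refl

pick-++-∷ : ∀ pre (y : ℕ) post → pick (length pre) (pre ++ y ∷ post) ≡ (y , pre ++ post)
pick-++-∷ []        y post = refl
pick-++-∷ (x ∷ pre) y post rewrite pick-++-∷ pre y post = refl

decodeFrom-↭ : ∀ avail {cs} → IsCode cs → length cs ≡ length avail → decodeFrom avail cs ↭ avail
decodeFrom-↭ []      []      _  = ↭-refl
decodeFrom-↭ (_ ∷ _) []      ()
decodeFrom-↭ avail {c ∷ cs} (c≤l ∷ cs-code) len≡
  with split-at avail (subst (c <_) len≡ (s≤s c≤l))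
... | pre , y , post , refl , refl rewrite pick-++-∷ pre y post =
  ↭-trans (prep y (decodeFrom-↭ (pre ++ post) cs-code (suc-injective (trans len≡ (length-++-sucʳ pre y post)))))
          (↭-sym (shift y pre post))

lehmer-decodeFrom : ∀ avail {cs} → Sorted avail → IsCode cs → length cs ≡ length avail →
  lehmer (decodeFrom avail cs) ≡ cs
lehmer-decodeFrom []      _ []      _  = refl
lehmer-decodeFrom (_ ∷ _) _ []      ()
lehmer-decodeFrom avail {c ∷ cs} sorted (c≤l ∷ cs-code) len≡
  with split-at avail (subst (c <_) len≡ (s≤s c≤l))
... | pre , y , post , refl , refl rewrite pick-++-∷ pre y post
  with sorted-++-∷⁻ pre sorted
... | pre<y , y<post , sorted′ =
  cong₂ _∷_ (count-<-↭ pre pre<y y<post (decodeFrom-↭ (pre ++ post) cs-code len≡′))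
            (lehmer-decodeFrom (pre ++ post) sorted′ cs-code len≡′)
  where
  len≡′ : length cs ≡ length (pre ++ post)
  len≡′ = suc-injective (trans len≡ (length-++-sucʳ pre y post))

decodeFrom-lehmer : ∀ avail {σ} → Sorted avail → σ ↭ avail → decodeFrom avail (lehmer σ) ≡ σ
decodeFrom-lehmer avail {[]}     _      _    = refl
decodeFrom-lehmer avail {x ∷ xs} sorted σ↭ with ∈-∃++ (∈-resp-↭ σ↭ (here refl))
... | pre , post , refl with sorted-++-∷⁻ pre sorted
... | pre<x , x<post , sorted′
  rewrite count-<-↭ pre pre<x x<post (drop-mid [] pre σ↭) | pick-++-∷ pre x post =
  cong (x ∷_) (decodeFrom-lehmer (pre ++ post) sorted′ (drop-mid [] pre σ↭))

sorted-upTo : ∀ n → Sorted (upTo n)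
sorted-upTo n = AllPairsP.applyUpTo⁺₁ id n (λ i<j _ → i<j)

lehmer-injective : ∀ n {τ τ′} → τ ↭ upTo n → τ′ ↭ upTo n → lehmer τ ≡ lehmer τ′ → τ ≡ τ′
lehmer-injective n {τ} {τ′} τ↭ τ′↭ eq = begin
  τ                               ≡⟨ decodeFrom-lehmer (upTo n) (sorted-upTo n) τ↭ ⟨
  decodeFrom (upTo n) (lehmer τ)  ≡⟨ cong (decodeFrom (upTo n)) eq ⟩
  decodeFrom (upTo n) (lehmer τ′) ≡⟨ decodeFrom-lehmer (upTo n) (sorted-upTo n) τ′↭ ⟩
  τ′                              ∎

length-lehmer-↭ : ∀ {n τ} → τ ↭ upTo n → length (lehmer τ) ≡ length (upTo n)
length-lehmer-↭ {τ = τ} τ↭ = trans (length-lehmer τ) (↭-length τ↭)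

module _ (n : ℕ) {τ : List ℕ} (τ↭ : τ ↭ upTo n) where

  private
    rotated-isCode : IsCode (rotCode (lehmer τ))
    rotated-isCode = rotCode-isCode (lehmer-isCode τ)

    length-rotated : length (rotCode (lehmer τ)) ≡ length (upTo n)
    length-rotated = trans (length-rotCode (lehmer τ)) (length-lehmer-↭ τ↭)

  𝓛-↭ : 𝓛 n τ ↭ upTo n
  𝓛-↭ = decodeFrom-↭ (upTo n) rotated-isCode length-rotated

  lehmer-𝓛 : lehmer (𝓛 n τ) ≡ rotCode (lehmer τ)
  lehmer-𝓛 = lehmer-decodeFrom (upTo n) (sorted-upTo n) rotated-isCode length-rotated

iter-𝓛-↭ : ∀ n k {σ} → σ ↭ upTo n → iter (𝓛 n) k σ ↭ upTo n
iter-𝓛-↭ n zero    σ↭ = σ↭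
iter-𝓛-↭ n (suc k) σ↭ = 𝓛-↭ n (iter-𝓛-↭ n k σ↭)

lehmer-iter-𝓛 : ∀ n k {σ} → σ ↭ upTo n → lehmer (iter (𝓛 n) k σ) ≡ iter rotCode k (lehmer σ)
lehmer-iter-𝓛 n zero    σ↭ = refl
lehmer-iter-𝓛 n (suc k) σ↭ =
  trans (lehmer-𝓛 n (iter-𝓛-↭ n k σ↭)) (cong rotCode (lehmer-iter-𝓛 n k σ↭))

theorem4p7 : (n : ℕ) → n ≥ 1 → (σ : List ℕ) → σ ↭ upTo n →
    Σ (List (List ℕ)) (λ orb →
      Unique orb × length orb ≡ lcmUpTo n ×
      ((τ : List ℕ) → (τ ∈ orb) ⇔ ∃ (λ k → iter (𝓛 n) k σ ≡ τ)))
theorem4p7 n _ σ σ↭ =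
  orbit-of-exact-period (𝓛 n) σ (lcmUpTo n) {{lcmUpTo-nonZero n}} period minimal
  where
  rotate : ℕ → List ℕ
  rotate k = iter rotCode k (lehmer σ)

  rotate-fixed⇔ : ∀ k d → iter rotCode d (rotate k) ≡ rotate k ⇔ lcmUpTo n ∣ d
  rotate-fixed⇔ k d =
    subst (λ l → iter rotCode d (rotate k) ≡ rotate k ⇔ lcmUpTo l ∣ d)
          (trans (length-iter-rotCode k (lehmer σ)) (trans (length-lehmer-↭ σ↭) (length-upTo n)))
          (iter-rotCode≡id⇔ (iter-rotCode-isCode k (lehmer-isCode σ)))

  period : iter (𝓛 n) (lcmUpTo n) σ ≡ σ
  period = lehmer-injective n (iter-𝓛-↭ n (lcmUpTo n) σ↭) σ↭
    (trans (lehmer-iter-𝓛 n (lcmUpTo n) σ↭) (from (rotate-fixed⇔ 0 (lcmUpTo n)) ∣-refl))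

  minimal : ∀ i d → iter (𝓛 n) (d + i) σ ≡ iter (𝓛 n) i σ → lcmUpTo n ∣ d
  minimal i d eq = to (rotate-fixed⇔ i d) (begin
    iter rotCode d (rotate i)     ≡⟨ iter-+ rotCode d i (lehmer σ) ⟨
    rotate (d + i)                ≡⟨ lehmer-iter-𝓛 n (d + i) σ↭ ⟨
    lehmer (iter (𝓛 n) (d + i) σ) ≡⟨ cong lehmer eq ⟩
    lehmer (iter (𝓛 n) i σ)       ≡⟨ lehmer-iter-𝓛 n i σ↭ ⟩
    rotate i                      ∎)
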